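{- Let $\sigma$ be a permutation of $[n]$ and let $i\in[n]$. Then $31\text{ - }2(i)+2\text{ - }31(i)=h_i$ if $i$ is the beginning of an ascent, and $31\text{ - }2(i)+2\text{ - }31(i)=h_i-1$ if $i$ is the beginning of a descent.
   Context: Given a permutation $\sigma$ of $[n]$, set $\sigma(0)=0$ and $\sigma(n+1)=n+1$. For a value $v\in[n]$ with $\sigma(j)=v$: $v$ is a valley if $\sigma(j-1)>\sigma(j)<\sigma(j+1)$, a peak if $\sigma(j-1)<\sigma(j)>\sigma(j+1)$, the beginning of an ascent if $\sigma(j)<\sigma(j+1)$, and the beginning of a descent if $\sigma(j)>\sigma(j+1)$. For $\sigma(j)=i$, $31\text{ - }2(i)$ is the number of indices $k$ with $1\le k<j$ and $\sigma(k-1)>\sigma(j)>\sigma(k)$, and $2\text{ - }31(i)$ is the number of indices $k$ with $j<k\le n+1$ and $\sigma(k-1)>\sigma(j)>\sigma(k)$. Define $h_i=|\{v<i : v \text{ is a valley}\}|-|\{v<i : v\text{ is a peak}\}|$ (the height before step $i$ of the Françon–Viennot Motzkin path whose $v$-th step is $N$ if $v$ is a valley and $S$ if $v$ is a peak, horizontal otherwise). -}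

module Defs where

open import Data.Nat using (ℕ; zero; suc; _+_; _∸_; _<_; _>_; _<?_)
open import Data.Nat.Properties using (_≟_)
open import Data.Fin using (Fin; toℕ; fromℕ<)
open import Data.Fin.Permutation using (Permutation′; _⟨$⟩ʳ_; _⟨$⟩ˡ_)
open import Data.List using (List; length; filter; upTo; map; allFin)
open import Data.Integer using (ℤ; +_; _-_)
open import Data.Product using (_×_)
open import Relation.Nullary using (Dec; yes; no)
open import Relation.Nullary.Decidable using (_×-dec_)

-- A permutation σ of [n] is a bijection Fin n → Fin n; the value/position
-- k : Fin n represents the integer toℕ k + 1 ∈ [n].

-- Extended one-line notation: ext σ 0 = 0, ext σ j = σ(j) for 1 ≤ j ≤ n,
-- ext σ (n+1) = n+1 (values beyond n+1 are irrelevant and set to n+1).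
ext : {n : ℕ} → Permutation′ n → ℕ → ℕ
ext {n} σ zero = zero
ext {n} σ (suc j) with j <? n
... | yes j<n = suc (toℕ (σ ⟨$⟩ʳ fromℕ< j<n))
... | no _ = suc n

pos : {n : ℕ} → Permutation′ n → Fin n → ℕ
pos σ i = suc (toℕ (σ ⟨$⟩ˡ i))

val : {n : ℕ} → Fin n → ℕ
val i = suc (toℕ i)

range : ℕ → ℕ → List ℕ
range a b = map (λ x → a + x) (upTo (b ∸ a))

IsValley : {n : ℕ} → Permutation′ n → Fin n → Set
IsValley σ v = (ext σ (pos σ v ∸ 1) > ext σ (pos σ v)) × (ext σ (pos σ v) < ext σ (suc (pos σ v)))

IsPeak : {n : ℕ} → Permutation′ n → Fin n → Set
IsPeak σ v = (ext σ (pos σ v ∸ 1) < ext σ (pos σ v)) × (ext σ (pos σ v) > ext σ (suc (pos σ v)))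

IsAscentStart : {n : ℕ} → Permutation′ n → Fin n → Set
IsAscentStart σ v = ext σ (pos σ v) < ext σ (suc (pos σ v))

IsDescentStart : {n : ℕ} → Permutation′ n → Fin n → Set
IsDescentStart σ v = ext σ (pos σ v) > ext σ (suc (pos σ v))

isValley? : {n : ℕ} (σ : Permutation′ n) (v : Fin n) → Dec (IsValley σ v)
isValley? σ v = (ext σ (pos σ v) <? ext σ (pos σ v ∸ 1)) ×-dec (ext σ (pos σ v) <? ext σ (suc (pos σ v)))

isPeak? : {n : ℕ} (σ : Permutation′ n) (v : Fin n) → Dec (IsPeak σ v)
isPeak? σ v = (ext σ (pos σ v ∸ 1) <? ext σ (pos σ v)) ×-dec (ext σ (suc (pos σ v)) <? ext σ (pos σ v))

Straddles : {n : ℕ} → Permutation′ n → ℕ → ℕ → Set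
Straddles σ x k = (ext σ (k ∸ 1) > x) × (x > ext σ k)

straddles? : {n : ℕ} (σ : Permutation′ n) (x k : ℕ) → Dec (Straddles σ x k)
straddles? σ x k = (x <? ext σ (k ∸ 1)) ×-dec (ext σ k <? x)

pat31-2 : {n : ℕ} → Permutation′ n → Fin n → ℕ
pat31-2 σ i = length (filter (straddles? σ (val i)) (range 1 (pos σ i)))

pat2-31 : {n : ℕ} → Permutation′ n → Fin n → ℕ
pat2-31 {n} σ i = length (filter (straddles? σ (val i)) (range (suc (pos σ i)) (n + 2)))

valuesBelow : {n : ℕ} → Fin n → List (Fin n)
valuesBelow {n} i = filter (λ v → toℕ v <? toℕ i) (allFin n)

height : {n : ℕ} → Permutation′ n → Fin n → ℤ
height σ i = + length (filter (isValley? σ) (valuesBelow i)) - + length (filter (isPeak? σ) (valuesBelow i))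

-- Read σ, padded with σ(0) = 0 and σ(n+1) = n+1, as a walk and fix the level c = i.
-- The values v < i sit exactly at the positions where the walk is below c, so h_i is the
-- number of valleys minus the number of peaks below c.  At a position below c,
-- [valley] + [left downwards] = [peak] + [entered from above], and a step entering a value
-- below c from above either starts below c (and leaves that position downwards) or crosses
-- c downwards.  Summed over positions this telescopes, because the walk starts and ends
-- with an ascent, so h_i counts the downward crossings of c.  Those starting strictly above
-- c are the k counted by 31-2(i) + 2-31(i); the only other one starts at c itself and
-- exists iff i begins a descent.

module Submission where

open import Data.Bool using (Bool; true; false; _∧_; not)
open import Data.Bool.Properties using (∧-zeroʳ)
open import Data.Empty using (⊥-elim)
open import Data.Fin using (Fin; toℕ; fromℕ<; zero; suc)
open import Data.Fin.Permutation using (Permutation′; _⟨$⟩ʳ_; _⟨$⟩ˡ_; inverseˡ; inverseʳ)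
open import Data.Fin.Properties using (toℕ<n; toℕ-injective; toℕ-fromℕ<; fromℕ<-toℕ)
open import Data.Integer using (+_; _-_; 1ℤ; _⊖_)
open import Data.Integer.Properties using ([+m]-[+n]≡m⊖n; +-cancelˡ-⊖)
open import Data.List using ([]; _∷_; length; filter; tabulate; applyUpTo; allFin)
open import Data.List.Properties using (map-applyUpTo)
open import Data.Nat using (ℕ; zero; suc; _+_; _∸_; _<_; _≤_; _<?_; _≤?_; _≟_; z≤n; s≤s)
open import Data.Nat.Properties
  using ( +-identityʳ; +-assoc; +-comm; m+[n∸m]≡n; +-0-commutativeMonoid; +-commutativeSemigroup
        ; suc-injective; 0≢1+n; n<1+n; <-irrefl; <-asym; <-trans; <-≤-trans; <⇒≤; <⇒≱; ≤⇒≯; ≤-refl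
        ; ≤∧≢⇒<; ≮⇒≥; <⇒≢)
open import Algebra.Properties.CommutativeMonoid.Sum +-0-commutativeMonoid
  using (sum-syntax; sum-cong-≗; ∑-distrib-+; ∑-permute)
open import Algebra.Properties.CommutativeSemigroup +-commutativeSemigroup using (x∙yz≈y∙xz)
open import Data.Product using (_×_; _,_)
open import Function using (_∘_; id)
open import Level using (Level)
open import Relation.Binary.PropositionalEquality
  using (_≡_; _≢_; refl; sym; trans; cong; cong₂; subst; module ≡-Reasoning)
open import Relation.Nullary using (Dec; yes; no; does)
open import Relation.Nullary.Decidable using (dec-true; dec-false)
open import Relation.Unary using (Pred; Decidable)
open import Relation.Unary.Properties using (_∩?_)

open import Defs

private
  variable
    ℓ ℓ₁ ℓ₂ : Level

𝟙 : Bool → ℕ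
𝟙 true = 1
𝟙 false = 0

∑-snoc : ∀ m (f : ℕ → ℕ) → ∑[ t < suc m ] f (toℕ t) ≡ ∑[ t < m ] f (toℕ t) + f m
∑-snoc zero f = +-identityʳ (f 0)
∑-snoc (suc m) f = trans (cong (_+_ (f 0)) (∑-snoc m (f ∘ suc))) (sym (+-assoc (f 0) _ _))

∑-split : ∀ m l (f : ℕ → ℕ) →
          ∑[ t < m + l ] f (toℕ t) ≡ ∑[ t < m ] f (toℕ t) + ∑[ t < l ] f (m + toℕ t)
∑-split zero l f = refl
∑-split (suc m) l f = trans (cong (_+_ (f 0)) (∑-split m l (f ∘ suc))) (sym (+-assoc (f 0) _ _))

∑-zero : ∀ m (f : ℕ → ℕ) → (∀ t → f t ≡ 0) → ∑[ t < m ] f (toℕ t) ≡ 0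
∑-zero zero f f≡0 = refl
∑-zero (suc m) f f≡0 = cong₂ _+_ (f≡0 0) (∑-zero m (f ∘ suc) (f≡0 ∘ suc))

∑-spike : ∀ m (f : ℕ → ℕ) j → j < m → (∀ t → t ≢ j → f t ≡ 0) → ∑[ t < m ] f (toℕ t) ≡ f j
∑-spike (suc m) f zero _ f≡0 =
  trans (cong (_+_ (f 0)) (∑-zero m (f ∘ suc) (λ t → f≡0 (suc t) (0≢1+n ∘ sym)))) (+-identityʳ (f 0))
∑-spike (suc m) f (suc j) (s≤s j<m) f≡0 =
  cong₂ _+_ (f≡0 0 0≢1+n) (∑-spike m (f ∘ suc) j j<m (λ t t≢j → f≡0 (suc t) (t≢j ∘ suc-injective)))

telescope : ∀ m (f g X : ℕ → ℕ) → (∀ q → q < m → f q + X (suc q) ≡ g q + X q) →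
            ∑[ q < m ] f (toℕ q) + X m ≡ ∑[ q < m ] g (toℕ q) + X 0
telescope zero f g X step = refl
telescope (suc m) f g X step = begin
  (f 0 + F) + X (suc m)  ≡⟨ +-assoc (f 0) F _ ⟩
  f 0 + (F + X (suc m))  ≡⟨ cong (_+_ (f 0)) (telescope m (f ∘ suc) (g ∘ suc) (X ∘ suc) (λ q → step (suc q) ∘ s≤s)) ⟩
  f 0 + (G + X 1)        ≡⟨ x∙yz≈y∙xz (f 0) G (X 1) ⟩
  G + (f 0 + X 1)        ≡⟨ cong (_+_ G) (step 0 (s≤s z≤n)) ⟩
  G + (g 0 + X 0)        ≡⟨ x∙yz≈y∙xz G (g 0) (X 0) ⟩
  g 0 + (G + X 0)        ≡⟨ sym (+-assoc (g 0) G (X 0)) ⟩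
  (g 0 + G) + X 0        ∎
  where
  open ≡-Reasoning
  F G : ℕ
  F = ∑[ q < m ] f (suc (toℕ q))
  G = ∑[ q < m ] g (suc (toℕ q))

module _ {A : Set ℓ} {P : Pred A ℓ₁} (P? : Decidable P) where

  filter-filter : ∀ {Q : Pred A ℓ₂} (Q? : Decidable Q) xs → filter Q? (filter P? xs) ≡ filter (P? ∩? Q?) xs
  filter-filter Q? []       = refl
  filter-filter Q? (x ∷ xs) with does (P? x)
  ... | false = filter-filter Q? xs
  ... | true with does (Q? x)
  ...   | true  = cong (x ∷_) (filter-filter Q? xs)
  ...   | false = filter-filter Q? xs

  length-filter-tabulate : ∀ m (f : Fin m → A) →
    length (filter P? (tabulate f)) ≡ ∑[ t < m ] 𝟙 (does (P? (f t)))
  length-filter-tabulate zero    f = refl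
  length-filter-tabulate (suc m) f with does (P? (f zero))
  ... | true  = cong suc (length-filter-tabulate m (f ∘ suc))
  ... | false = length-filter-tabulate m (f ∘ suc)

  length-filter-applyUpTo : ∀ m (f : ℕ → A) →
    length (filter P? (applyUpTo f m)) ≡ ∑[ t < m ] 𝟙 (does (P? (f (toℕ t))))
  length-filter-applyUpTo zero    f = refl
  length-filter-applyUpTo (suc m) f with does (P? (f 0))
  ... | true  = cong suc (length-filter-applyUpTo m (f ∘ suc))
  ... | false = length-filter-applyUpTo m (f ∘ suc)

length-filter-range : ∀ {P : Pred ℕ ℓ₁} (P? : Decidable P) a b →
  length (filter P? (range a b)) ≡ ∑[ t < b ∸ a ] 𝟙 (does (P? (a + toℕ t)))
length-filter-range P? a b =
  trans (cong (length ∘ filter P?) (map-applyUpTo id (_+_ a) (b ∸ a))) (length-filter-applyUpTo P? (b ∸ a) (_+_ a))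

+[m+n]-+m≡+n : ∀ m n → + (m + n) - + m ≡ + n
+[m+n]-+m≡+n m n = begin
  + (m + n) - + m      ≡⟨ [+m]-[+n]≡m⊖n (m + n) m ⟩
  (m + n) ⊖ m          ≡⟨ cong ((m + n) ⊖_) (sym (+-identityʳ m)) ⟩
  (m + n) ⊖ (m + 0)    ≡⟨ +-cancelˡ-⊖ m n 0 ⟩
  + n                  ∎
  where open ≡-Reasoning

<?-flip : ∀ {x y} → x ≢ y → does (x <? y) ≡ not (does (y <? x))
<?-flip {x} {y} x≢y = flip (x <? y) (y <? x)
  where
  flip : (x<?y : Dec (x < y)) (y<?x : Dec (y < x)) → does x<?y ≡ not (does y<?x)
  flip (yes x<y) (yes y<x) = ⊥-elim (<-asym x<y y<x)
  flip (yes _)   (no _)    = refl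
  flip (no _)    (yes _)   = refl
  flip (no x≮y)  (no y≮x)  = ⊥-elim (x≮y (≤∧≢⇒< (≮⇒≥ y≮x) x≢y))

≤?-split : ∀ c x b → 𝟙 (does (c ≤? x) ∧ b) ≡ 𝟙 (does (c <? x) ∧ b) + 𝟙 (does (x ≟ c) ∧ b)
≤?-split c x b = split (c ≤? x) (c <? x) (x ≟ c) b
  where
  split : (c≤?x : Dec (c ≤ x)) (c<?x : Dec (c < x)) (x≟c : Dec (x ≡ c)) (b : Bool) →
          𝟙 (does c≤?x ∧ b) ≡ 𝟙 (does c<?x ∧ b) + 𝟙 (does x≟c ∧ b)
  split (yes _)   (yes c<x) (yes refl) _     = ⊥-elim (<-irrefl refl c<x)
  split (yes c≤x) (no c≮x)  (no x≢c)   _     = ⊥-elim (c≮x (≤∧≢⇒< c≤x (x≢c ∘ sym)))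
  split (no c≰x)  (yes c<x) _          _     = ⊥-elim (c≰x (<⇒≤ c<x))
  split (no c≰x)  (no _)    (yes refl) _     = ⊥-elim (c≰x ≤-refl)
  split (yes _)   (yes _)   (no _)     b     = sym (+-identityʳ (𝟙 b))
  split (yes _)   (no _)    (yes _)    b     = refl
  split (no _)    (no _)    (no _)     b     = refl

descent-into-split : ∀ c x y →
  𝟙 (does (y <? c) ∧ does (y <? x)) ≡ 𝟙 (does (c ≤? x) ∧ does (y <? c)) + 𝟙 (does (x <? c) ∧ does (y <? x))
descent-into-split c x y = split (y <? c) (y <? x) (c ≤? x) (x <? c)
  where
  split : (y<?c : Dec (y < c)) (y<?x : Dec (y < x)) (c≤?x : Dec (c ≤ x)) (x<?c : Dec (x < c)) →
          𝟙 (does y<?c ∧ does y<?x) ≡ 𝟙 (does c≤?x ∧ does y<?c) + 𝟙 (does x<?c ∧ does y<?x)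
  split _          _          (yes c≤x) (yes x<c) = ⊥-elim (<⇒≱ x<c c≤x)
  split _          _          (no c≰x)  (no x≮c)  = ⊥-elim (c≰x (≮⇒≥ x≮c))
  split (no y≮c)   (yes y<x)  (no _)    (yes x<c) = ⊥-elim (y≮c (<-trans y<x x<c))
  split (yes y<c)  (no y≮x)   (yes c≤x) (no _)    = ⊥-elim (y≮x (<-≤-trans y<c c≤x))
  split (yes _)    (yes _)    (no _)    (yes _)   = refl
  split (yes _)    (no _)     (no _)    (yes _)   = refl
  split (no _)     (no _)     (no _)    (yes _)   = refl
  split (yes _)    (yes _)    (yes _)   (no _)    = refl
  split (no _)     (yes _)    (yes _)   (no _)    = refl
  split (no _)     (no _)     (yes _)   (no _)    = refl

∧-not-exchange : ∀ C A B → 𝟙 (C ∧ (A ∧ not B)) + 𝟙 (C ∧ B) ≡ 𝟙 (C ∧ (not A ∧ B)) + 𝟙 (C ∧ A)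
∧-not-exchange false _     _     = refl
∧-not-exchange true  false false = refl
∧-not-exchange true  false true  = refl
∧-not-exchange true  true  false = refl
∧-not-exchange true  true  true  = refl

valleyAt peakAt : (ℕ → ℕ) → ℕ → Bool
valleyAt a q = does (a q <? a (q ∸ 1)) ∧ does (a q <? a (suc q))
peakAt a q = does (a (q ∸ 1) <? a q) ∧ does (a (suc q) <? a q)

module _ (a : ℕ → ℕ) (c : ℕ) where

  valleyBelow peakBelow descentBelow downCrossing straddle leavesLevel : ℕ → Bool
  valleyBelow q = does (a q <? c) ∧ valleyAt a q
  peakBelow q = does (a q <? c) ∧ peakAt a q
  descentBelow q = does (a q <? c) ∧ does (a (suc q) <? a q)
  downCrossing k = does (c ≤? a (k ∸ 1)) ∧ does (a k <? c)
  straddle k = does (c <? a (k ∸ 1)) ∧ does (a k <? c)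
  leavesLevel k = does (a (k ∸ 1) ≟ c) ∧ does (a k <? c)

  valley+descent≡peak+crossing+descent : ∀ q → a q ≢ a (suc q) → a (suc q) ≢ a (suc (suc q)) →
    𝟙 (valleyBelow (suc q)) + 𝟙 (descentBelow (suc q)) ≡
    (𝟙 (peakBelow (suc q)) + 𝟙 (downCrossing (suc q))) + 𝟙 (descentBelow q)
  valley+descent≡peak+crossing+descent q x≢y y≢z = begin
    𝟙 (C ∧ (A ∧ does (y <? z))) + 𝟙 (C ∧ B)  ≡⟨ cong (λ b → 𝟙 (C ∧ (A ∧ b)) + 𝟙 (C ∧ B)) (<?-flip y≢z) ⟩
    𝟙 (C ∧ (A ∧ not B)) + 𝟙 (C ∧ B)          ≡⟨ ∧-not-exchange C A B ⟩
    𝟙 (C ∧ (not A ∧ B)) + 𝟙 (C ∧ A)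
      ≡⟨ cong₂ (λ b s → 𝟙 (C ∧ (b ∧ B)) + s) (sym (<?-flip x≢y)) (descent-into-split c x y) ⟩
    𝟙 (peakBelow (suc q)) + (𝟙 (downCrossing (suc q)) + 𝟙 (descentBelow q))
                                              ≡⟨ sym (+-assoc (𝟙 (peakBelow (suc q))) _ _) ⟩
    (𝟙 (peakBelow (suc q)) + 𝟙 (downCrossing (suc q))) + 𝟙 (descentBelow q) ∎
    where
    open ≡-Reasoning
    x y z : ℕ
    x = a q
    y = a (suc q)
    z = a (suc (suc q))
    A B C : Bool
    A = does (y <? x)
    B = does (z <? y)
    C = does (y <? c)

  ascent⇒¬descentBelow : ∀ {q} → a q < a (suc q) → descentBelow q ≡ false
  ascent⇒¬descentBelow {q} aq<aq+1 =
    trans (cong (does (a q <? c) ∧_) (dec-false (a (suc q) <? a q) (<-asym aq<aq+1))) (∧-zeroʳ _)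

  level≤⇒¬descentBelow : ∀ {q} → c ≤ a (suc q) → descentBelow q ≡ false
  level≤⇒¬descentBelow {q} c≤aq+1 with a q <? c
  ... | yes aq<c = ascent⇒¬descentBelow (<-≤-trans aq<c c≤aq+1)
  ... | no aq≮c  = cong (_∧ does (a (suc q) <? a q)) (dec-false (a q <? c) aq≮c)

  level≤⇒¬downCrossing : ∀ {k} → c ≤ a k → downCrossing k ≡ false
  level≤⇒¬downCrossing {k} c≤ak =
    trans (cong (does (c ≤? a (k ∸ 1)) ∧_) (dec-false (a k <? c) (≤⇒≯ c≤ak))) (∧-zeroʳ _)

  level≡⇒¬straddle : ∀ {k} → a k ≡ c → straddle k ≡ false
  level≡⇒¬straddle {k} ak≡c =
    trans (cong (does (c <? a (k ∸ 1)) ∧_) (dec-false (a k <? c) (<-irrefl ak≡c))) (∧-zeroʳ _)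

  valleysBelow≡peaksBelow+downCrossings : ∀ n → a 0 < a 1 → c ≤ a (suc n) →
    (∀ q → q ≤ n → a q ≢ a (suc q)) →
    ∑[ q < n ] 𝟙 (valleyBelow (suc (toℕ q))) ≡
    ∑[ q < n ] 𝟙 (peakBelow (suc (toℕ q))) + ∑[ k < suc n ] 𝟙 (downCrossing (suc (toℕ k)))
  valleysBelow≡peaksBelow+downCrossings n a0<a1 c≤an+1 distinct = begin
    V                                        ≡⟨ sym (+-identityʳ V) ⟩
    V + 0                                    ≡⟨ cong (λ b → V + 𝟙 b) (sym (level≤⇒¬descentBelow c≤an+1)) ⟩
    V + 𝟙 (descentBelow n)                   ≡⟨ telescope n f g (𝟙 ∘ descentBelow) step ⟩
    ∑[ q < n ] g (toℕ q) + 𝟙 (descentBelow 0)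
                                             ≡⟨ cong (λ b → ∑[ q < n ] g (toℕ q) + 𝟙 b) (ascent⇒¬descentBelow a0<a1) ⟩
    ∑[ q < n ] g (toℕ q) + 0                 ≡⟨ +-identityʳ _ ⟩
    ∑[ q < n ] g (toℕ q)                     ≡⟨ ∑-distrib-+ {n} (λ q → 𝟙 (peakBelow (suc (toℕ q)))) (D ∘ toℕ) ⟩
    P + ∑[ k < n ] D (toℕ k)                 ≡⟨ cong (_+_ P) (sym lastCrossingVanishes) ⟩
    P + ∑[ k < suc n ] D (toℕ k)             ∎
    where
    open ≡-Reasoning
    f g D : ℕ → ℕ
    f q = 𝟙 (valleyBelow (suc q))
    D k = 𝟙 (downCrossing (suc k))
    g q = 𝟙 (peakBelow (suc q)) + D q
    V P : ℕ
    V = ∑[ q < n ] f (toℕ q)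
    P = ∑[ q < n ] 𝟙 (peakBelow (suc (toℕ q)))
    step : ∀ q → q < n → f q + 𝟙 (descentBelow (suc q)) ≡ g q + 𝟙 (descentBelow q)
    step q q<n = valley+descent≡peak+crossing+descent q (distinct q (<⇒≤ q<n)) (distinct (suc q) q<n)
    lastCrossingVanishes : ∑[ k < suc n ] D (toℕ k) ≡ ∑[ k < n ] D (toℕ k)
    lastCrossingVanishes = begin
      ∑[ k < suc n ] D (toℕ k)     ≡⟨ ∑-snoc n D ⟩
      ∑[ k < n ] D (toℕ k) + D n   ≡⟨ cong (λ b → ∑[ k < n ] D (toℕ k) + 𝟙 b) (level≤⇒¬downCrossing c≤an+1) ⟩
      ∑[ k < n ] D (toℕ k) + 0     ≡⟨ +-identityʳ _ ⟩
      ∑[ k < n ] D (toℕ k)         ∎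

  ∑leavesLevel≡𝟙[a[1+p]<c] : ∀ m p → p < m → a p ≡ c → (∀ k → a k ≡ c → k ≡ p) →
    ∑[ k < m ] 𝟙 (leavesLevel (suc (toℕ k))) ≡ 𝟙 (does (a (suc p) <? c))
  ∑leavesLevel≡𝟙[a[1+p]<c] m p p<m ap≡c onlyAt-p =
    trans (∑-spike m (𝟙 ∘ leavesLevel ∘ suc) p p<m vanishes)
          (cong (λ b → 𝟙 (b ∧ does (a (suc p) <? c))) (dec-true (a p ≟ c) ap≡c))
    where
    vanishes : ∀ k → k ≢ p → 𝟙 (leavesLevel (suc k)) ≡ 0
    vanishes k k≢p = cong (λ b → 𝟙 (b ∧ does (a (suc k) <? c))) (dec-false (a k ≟ c) (k≢p ∘ onlyAt-p k))

  valleysBelow≡peaksBelow+straddles+descent : ∀ n p → a 0 < a 1 → c ≤ a (suc n) →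
    (∀ q → q ≤ n → a q ≢ a (suc q)) → p ≤ n → a p ≡ c → (∀ k → a k ≡ c → k ≡ p) →
    ∑[ q < n ] 𝟙 (valleyBelow (suc (toℕ q))) ≡
    ∑[ q < n ] 𝟙 (peakBelow (suc (toℕ q))) + ∑[ k < suc n ] 𝟙 (straddle (suc (toℕ k))) + 𝟙 (does (a (suc p) <? c))
  valleysBelow≡peaksBelow+straddles+descent n p a0<a1 c≤an+1 distinct p≤n ap≡c onlyAt-p = begin
    ∑[ q < n ] 𝟙 (valleyBelow (suc (toℕ q)))  ≡⟨ valleysBelow≡peaksBelow+downCrossings n a0<a1 c≤an+1 distinct ⟩
    P + ∑[ k < suc n ] D k
      ≡⟨ cong (_+_ P) (sum-cong-≗ {x = D} {y = λ k → S k + L k} (λ k → ≤?-split c (a (toℕ k)) _)) ⟩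
    P + ∑[ k < suc n ] (S k + L k)            ≡⟨ cong (_+_ P) (∑-distrib-+ S L) ⟩
    P + (∑[ k < suc n ] S k + ∑[ k < suc n ] L k)
                                              ≡⟨ sym (+-assoc P _ _) ⟩
    P + ∑[ k < suc n ] S k + ∑[ k < suc n ] L k
      ≡⟨ cong (_+_ (P + ∑[ k < suc n ] S k)) (∑leavesLevel≡𝟙[a[1+p]<c] (suc n) p (s≤s p≤n) ap≡c onlyAt-p) ⟩
    P + ∑[ k < suc n ] S k + 𝟙 (does (a (suc p) <? c)) ∎
    where
    open ≡-Reasoning
    P : ℕ
    P = ∑[ q < n ] 𝟙 (peakBelow (suc (toℕ q)))
    D S L : Fin (suc n) → ℕ
    D k = 𝟙 (downCrossing (suc (toℕ k)))
    S k = 𝟙 (straddle (suc (toℕ k)))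
    L k = 𝟙 (leavesLevel (suc (toℕ k)))

module _ {n : ℕ} (σ : Permutation′ n) where

  ext-suc-< : ∀ j (j<n : j < n) → ext σ (suc j) ≡ val (σ ⟨$⟩ʳ fromℕ< j<n)
  ext-suc-< j j<n with j <? n
  ... | yes _   = refl
  ... | no j≮n = ⊥-elim (j≮n j<n)

  ext-suc : ∀ (p : Fin n) → ext σ (suc (toℕ p)) ≡ val (σ ⟨$⟩ʳ p)
  ext-suc p = trans (ext-suc-< (toℕ p) (toℕ<n p)) (cong (val ∘ (σ ⟨$⟩ʳ_)) (fromℕ<-toℕ p (toℕ<n p)))

  ext-beyond : ext σ (suc n) ≡ suc n
  ext-beyond with n <? n
  ... | yes n<n = ⊥-elim (<-irrefl refl n<n)
  ... | no _    = refl

  0<ext-suc : ∀ j → 0 < ext σ (suc j)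
  0<ext-suc j with j <? n
  ... | yes _ = s≤s z≤n
  ... | no _  = s≤s z≤n

  ext-pos : ∀ v → ext σ (pos σ v) ≡ val v
  ext-pos v = trans (ext-suc (σ ⟨$⟩ˡ v)) (cong val (inverseʳ σ))

  ext≡val⇒pos : ∀ v k → ext σ k ≡ val v → k ≡ pos σ v
  ext≡val⇒pos v zero ()
  ext≡val⇒pos v (suc j) e with j <? n
  ... | no _    = ⊥-elim (<-irrefl (sym (suc-injective e)) (toℕ<n v))
  ... | yes j<n = cong suc (begin
    j                                   ≡⟨ sym (toℕ-fromℕ< j<n) ⟩
    toℕ (fromℕ< j<n)                    ≡⟨ cong toℕ (sym (inverseˡ σ)) ⟩
    toℕ (σ ⟨$⟩ˡ (σ ⟨$⟩ʳ fromℕ< j<n))    ≡⟨ cong (toℕ ∘ (σ ⟨$⟩ˡ_)) (toℕ-injective (suc-injective e)) ⟩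
    toℕ (σ ⟨$⟩ˡ v)                      ∎)
    where open ≡-Reasoning

  ext-adjacent-distinct : ∀ q → q ≤ n → ext σ q ≢ ext σ (suc q)
  ext-adjacent-distinct zero    _   = <⇒≢ (0<ext-suc 0)
  ext-adjacent-distinct (suc j) j<n e =
    <-irrefl (trans (ext≡val⇒pos w (suc j) σj≡w) (sym (ext≡val⇒pos w (suc (suc j)) (trans (sym e) σj≡w))))
             (n<1+n (suc j))
    where
    w : Fin n
    w = σ ⟨$⟩ʳ fromℕ< j<n
    σj≡w : ext σ (suc j) ≡ val w
    σj≡w = ext-suc-< j j<n

module _ {n : ℕ} (σ : Permutation′ n) (i : Fin n) where

  descentIndicator : ℕ
  descentIndicator = 𝟙 (does (ext σ (suc (pos σ i)) <? val i))

  ascent⇒descentIndicator≡0 : IsAscentStart σ i → descentIndicator ≡ 0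
  ascent⇒descentIndicator≡0 σj<σj+1 =
    cong 𝟙 (dec-false (_ <? val i) (<-asym (subst (_< ext σ (suc (pos σ i))) (ext-pos σ i) σj<σj+1)))

  descent⇒descentIndicator≡1 : IsDescentStart σ i → descentIndicator ≡ 1
  descent⇒descentIndicator≡1 σj+1<σj =
    cong 𝟙 (dec-true (_ <? val i) (subst (ext σ (suc (pos σ i)) <_) (ext-pos σ i) σj+1<σj))

  length-filter-valuesBelow : ∀ {Q : Pred (Fin n) ℓ} (Q? : Decidable Q) (H : ℕ → Bool) →
    (∀ v → does (Q? v) ≡ H (pos σ v)) →
    length (filter Q? (valuesBelow i)) ≡ ∑[ p < n ] 𝟙 (does (ext σ (suc (toℕ p)) <? val i) ∧ H (suc (toℕ p)))
  length-filter-valuesBelow Q? H Q≡H = begin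
    length (filter Q? (filter below? (allFin n)))  ≡⟨ cong length (filter-filter below? Q? (allFin n)) ⟩
    length (filter (below? ∩? Q?) (tabulate id))   ≡⟨ length-filter-tabulate (below? ∩? Q?) n id ⟩
    ∑[ v < n ] belowQ v                            ≡⟨ sum-cong-≗ {x = belowQ} (λ v → cong (𝟙 ∘ (does (below? v) ∧_)) (Q≡H v)) ⟩
    ∑[ v < n ] belowH v                            ≡⟨ ∑-permute belowH σ ⟩
    ∑[ p < n ] belowH (σ ⟨$⟩ʳ p)                   ≡⟨ sum-cong-≗ {x = belowH ∘ (σ ⟨$⟩ʳ_)} toPositions ⟩
    ∑[ p < n ] 𝟙 (does (ext σ (suc (toℕ p)) <? val i) ∧ H (suc (toℕ p))) ∎
    where
    open ≡-Reasoning
    below? : Decidable (λ (v : Fin n) → toℕ v < toℕ i)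
    below? v = toℕ v <? toℕ i
    belowQ belowH : Fin n → ℕ
    belowQ v = 𝟙 (does (below? v) ∧ does (Q? v))
    belowH v = 𝟙 (does (below? v) ∧ H (pos σ v))
    toPositions : ∀ p → belowH (σ ⟨$⟩ʳ p) ≡ 𝟙 (does (ext σ (suc (toℕ p)) <? val i) ∧ H (suc (toℕ p)))
    toPositions p = cong₂ (λ x q → 𝟙 (does (x <? val i) ∧ H q)) (sym (ext-suc σ p)) (cong (suc ∘ toℕ) (inverseˡ σ))

  pat31-2+pat2-31≡∑straddles :
    pat31-2 σ i + pat2-31 σ i ≡ ∑[ k < suc n ] 𝟙 (straddle (ext σ) (val i) (suc (toℕ k)))
  pat31-2+pat2-31≡∑straddles = begin
    pat31-2 σ i + pat2-31 σ i                    ≡⟨ cong₂ _+_ (length-filter-range (straddles? σ (val i)) 1 (pos σ i)) after ⟩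
    ∑[ k < r ] S (toℕ k) + Rest                  ≡⟨ cong (λ x → x + Rest) (sym (+-identityʳ _)) ⟩
    ∑[ k < r ] S (toℕ k) + 0 + Rest              ≡⟨ cong (λ b → ∑[ k < r ] S (toℕ k) + 𝟙 b + Rest) (sym atLevel) ⟩
    ∑[ k < r ] S (toℕ k) + S r + Rest            ≡⟨ cong (λ x → x + Rest) (sym (∑-snoc r S)) ⟩
    ∑[ k < suc r ] S (toℕ k) + Rest              ≡⟨ sym (∑-split (suc r) (n ∸ r) S) ⟩
    ∑[ k < suc r + (n ∸ r) ] S (toℕ k)           ≡⟨ cong (λ m → ∑[ k < suc m ] S (toℕ k)) (m+[n∸m]≡n (<⇒≤ r<n)) ⟩
    ∑[ k < suc n ] S (toℕ k)                     ∎
    where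
    open ≡-Reasoning
    r : ℕ
    r = toℕ (σ ⟨$⟩ˡ i)
    r<n : r < n
    r<n = toℕ<n (σ ⟨$⟩ˡ i)
    S : ℕ → ℕ
    S k = 𝟙 (straddle (ext σ) (val i) (suc k))
    Rest : ℕ
    Rest = ∑[ t < n ∸ r ] S (suc r + toℕ t)
    after : pat2-31 σ i ≡ Rest
    after = trans (length-filter-range (straddles? σ (val i)) (suc (pos σ i)) (n + 2))
                  (cong (λ m → ∑[ t < m ∸ suc (pos σ i) ] S (suc r + toℕ t)) (+-comm n 2))
    atLevel : straddle (ext σ) (val i) (pos σ i) ≡ false
    atLevel = level≡⇒¬straddle (ext σ) (val i) (ext-pos σ i)

  valleys≡peaks+patterns+descent :
    length (filter (isValley? σ) (valuesBelow i)) ≡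
    length (filter (isPeak? σ) (valuesBelow i)) + (pat31-2 σ i + pat2-31 σ i) + descentIndicator
  valleys≡peaks+patterns+descent = begin
    length (filter (isValley? σ) (valuesBelow i))
      ≡⟨ length-filter-valuesBelow (isValley? σ) (valleyAt (ext σ)) (λ _ → refl) ⟩
    ∑[ q < n ] 𝟙 (valleyBelow (ext σ) (val i) (suc (toℕ q)))
      ≡⟨ valleysBelow≡peaksBelow+straddles+descent (ext σ) (val i) n (pos σ i)
           (0<ext-suc σ 0) c≤ext-beyond (ext-adjacent-distinct σ)
           (toℕ<n (σ ⟨$⟩ˡ i)) (ext-pos σ i) (λ k → ext≡val⇒pos σ i k) ⟩
    ∑[ q < n ] 𝟙 (peakBelow (ext σ) (val i) (suc (toℕ q))) + ∑[ k < suc n ] 𝟙 (straddle (ext σ) (val i) (suc (toℕ k))) + e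
      ≡⟨ cong₂ (λ x y → x + y + e) (sym (length-filter-valuesBelow (isPeak? σ) (peakAt (ext σ)) (λ _ → refl)))
                                   (sym pat31-2+pat2-31≡∑straddles) ⟩
    length (filter (isPeak? σ) (valuesBelow i)) + (pat31-2 σ i + pat2-31 σ i) + e ∎
    where
    open ≡-Reasoning
    e : ℕ
    e = descentIndicator
    c≤ext-beyond : val i ≤ ext σ (suc n)
    c≤ext-beyond = subst (val i ≤_) (sym (ext-beyond σ)) (<⇒≤ (s≤s (toℕ<n i)))

  height≡patterns+descent : height σ i ≡ + (pat31-2 σ i + pat2-31 σ i + descentIndicator)
  height≡patterns+descent = begin
    + V - + P             ≡⟨ cong (λ v → + v - + P) valleys≡peaks+patterns+descent ⟩
    + (P + K + e) - + P   ≡⟨ cong (λ v → + v - + P) (+-assoc P K e) ⟩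
    + (P + (K + e)) - + P ≡⟨ +[m+n]-+m≡+n P (K + e) ⟩
    + (K + e)             ∎
    where
    open ≡-Reasoning
    V P K e : ℕ
    V = length (filter (isValley? σ) (valuesBelow i))
    P = length (filter (isPeak? σ) (valuesBelow i))
    K = pat31-2 σ i + pat2-31 σ i
    e = descentIndicator

mainTheorem8 : (n : ℕ) (σ : Permutation′ n) (i : Fin n) →
    (IsAscentStart σ i → + (pat31-2 σ i + pat2-31 σ i) ≡ height σ i) ×
    (IsDescentStart σ i → + (pat31-2 σ i + pat2-31 σ i) ≡ height σ i - 1ℤ)
mainTheorem8 n σ i = ascent , descent
  where
  open ≡-Reasoning
  K : ℕ
  K = pat31-2 σ i + pat2-31 σ i
  ascent : IsAscentStart σ i → + K ≡ height σ i
  ascent isAscent = sym (begin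
    height σ i                           ≡⟨ height≡patterns+descent σ i ⟩
    + (K + descentIndicator σ i)         ≡⟨ cong (λ e → + (K + e)) (ascent⇒descentIndicator≡0 σ i isAscent) ⟩
    + (K + 0)                            ≡⟨ cong +_ (+-identityʳ K) ⟩
    + K                                  ∎)
  descent : IsDescentStart σ i → + K ≡ height σ i - 1ℤ
  descent isDescent = sym (begin
    height σ i - 1ℤ                      ≡⟨ cong (_- 1ℤ) (height≡patterns+descent σ i) ⟩
    + (K + descentIndicator σ i) - 1ℤ    ≡⟨ cong (λ e → + (K + e) - 1ℤ) (descent⇒descentIndicator≡1 σ i isDescent) ⟩
    + (K + 1) - + 1                      ≡⟨ cong (λ m → + m - + 1) (+-comm K 1) ⟩
    + (1 + K) - + 1                      ≡⟨ +[m+n]-+m≡+n 1 K ⟩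
    + K                                  ∎)
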